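{- Let $p$ be a prime and $n$ a positive integer divisible by $p^3$. If $R$ is a type-$p$ most-perfect square of order $n$, then $\theta(R)$ is pandiagonal, i.e., the entries of every broken diagonal of $\theta(R)$, in either direction, sum to $\frac{n(n^2-1)}{2}$.
   Context: A natural square of order $n$ is an $n\times n$ array containing each of $0,1,\dots,n^2-1$ exactly once; its magic sum is $\frac{n(n^2-1)}{2}$. Rows and columns are indexed $0,\dots,n-1$ with indices read modulo $n$. A natural square is pandiagonal magic if every row, every column, and every broken diagonal in either direction sums to $\frac{n(n^2-1)}{2}$. For $p\mid n$, a type-$p$ most-perfect square of order $n$ is a natural pandiagonal magic square $R$ of order $n$ such that (i) (complementary property) for every position $(r,c)$, the entries at positions $(r+t\frac np,\,c+t\frac np)$ (indices mod $n$), $t=0,\dots,p-1$, sum to $\frac{p(n^2-1)}{2}$; and (ii) ($p\times p$ property) the entries of every $p\times p$ subsquare formed from consecutive rows and columns (allowing toric wraparound) sum to $\frac{p^2(n^2-1)}{2}$. The map $\theta$ (depending on $p$) is defined on $n\times n$ arrays with $p^2\mid n$: view $R$ as a $p^2\times p^2$ block array $(R_{i,j})_{0\le i,j\le p^2-1}$ of $\frac{n}{p^2}\times\frac{n}{p^2}$ blocks; for $i=\ell p+m$ with $\ell,m\in\{0,\dots,p-1\}$ put $\bar i=mp+\ell$; then $[\theta(R)]_{i,j}=R_{\bar i,\bar j}$. -}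

module Defs where

open import Data.Nat using (ℕ; zero; suc; _+_; _*_; _∸_; _<_; NonZero; >-nonZero)
open import Data.Nat.DivMod using (_/_; _%_; m%n<n)
open import Data.Fin using (Fin; toℕ; fromℕ<)
open import Data.Product using (Σ; _×_; _,_)
open import Data.Nat.Properties using (m*n≢0)
open import Data.Nat.DivMod using (m≥n⇒m/n>0)
open import Data.Nat.Divisibility using (_∣_; ∣⇒≤; ∣-trans; m∣m*n)
open import Data.Nat.Primality using (Prime; prime⇒nonZero)
open import Relation.Binary.PropositionalEquality using (_≡_)

Square : ℕ → Set
Square n = Fin n → Fin n → ℕ

sumTo : ℕ → (ℕ → ℕ) → ℕ
sumTo zero    f = 0
sumTo (suc k) f = sumTo k f + f k

ix : (n : ℕ) → .{{_ : NonZero n}} → ℕ → Fin n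
ix n x = fromℕ< (m%n<n x n)

at : {n : ℕ} → .{{_ : NonZero n}} → Square n → ℕ → ℕ → ℕ
at {n} R r c = R (ix n r) (ix n c)

-- twice the magic sum, n (n^2 - 1)  (we compare 2·sum to avoid division)
twiceMagic : ℕ → ℕ
twiceMagic n = n * (n * n ∸ 1)

Natural : (n : ℕ) → Square n → Set
Natural n R =
  (∀ r c → R r c < n * n) ×
  (∀ r c r' c' → R r c ≡ R r' c' → (r ≡ r' × c ≡ c')) ×
  (∀ k → k < n * n → Σ (Fin n) λ r → Σ (Fin n) λ c → R r c ≡ k)

PandiagonalSums : (n : ℕ) → .{{_ : NonZero n}} → Square n → Set
PandiagonalSums n R =
  (∀ k → 2 * sumTo n (λ i → at R i (k + i)) ≡ twiceMagic n) ×
  (∀ k → 2 * sumTo n (λ i → at R i (k + (n ∸ i))) ≡ twiceMagic n)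

PandiagonalMagic : (n : ℕ) → .{{_ : NonZero n}} → Square n → Set
PandiagonalMagic n R =
  Natural n R ×
  (∀ r → 2 * sumTo n (λ c → at R r c) ≡ twiceMagic n) ×
  (∀ c → 2 * sumTo n (λ r → at R r c) ≡ twiceMagic n) ×
  PandiagonalSums n R

MostPerfect : (p n : ℕ) → .{{_ : NonZero p}} → .{{_ : NonZero n}} → Square n → Set
MostPerfect p n R =
  PandiagonalMagic n R ×
  (∀ r c → 2 * sumTo p (λ t → at R (r + t * (n / p)) (c + t * (n / p)))
             ≡ p * (n * n ∸ 1)) ×
  (∀ r c → 2 * sumTo p (λ a → sumTo p (λ b → at R (r + a) (c + b)))
             ≡ p * p * (n * n ∸ 1))

blockSize : (p n : ℕ) → Prime p → ℕ
blockSize p n pr = n / (p * p)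
  where instance
    _ = prime⇒nonZero pr
    _ = m*n≢0 p p

blockSize-nonZero : (p n : ℕ) (pr : Prime p) → .{{_ : NonZero n}} →
                    (p * p) ∣ n → NonZero (blockSize p n pr)
blockSize-nonZero p n pr d = >-nonZero (m≥n⇒m/n>0 (∣⇒≤ d))
  where instance
    _ = prime⇒nonZero pr
    _ = m*n≢0 p p

-- the index permutation underlying θ: a row/column index x lies in block
-- i = x / s (s = n/p²) at offset u = x % s; writing i = ℓp+m, the new block
-- index is ī = mp+ℓ and the offset is unchanged.
θidx : (p n : ℕ) (pr : Prime p) → .{{_ : NonZero n}} → (p * p) ∣ n → ℕ → ℕ
θidx p n pr d x =
  let s = blockSize p n pr
      i = x / s ; u = x % s
      ℓ = i / p ; m = i % p
  in (m * p + ℓ) * s + u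
  where instance
    _ = prime⇒nonZero pr
    _ = blockSize-nonZero p n pr d

θ : (p n : ℕ) (pr : Prime p) → .{{_ : NonZero n}} → (p * p) ∣ n →
    Square n → Square n
θ p n pr d R x y = at R (θidx p n pr d (toℕ x)) (θidx p n pr d (toℕ y))

p³∣n⇒p²∣n : (p n : ℕ) → (p * p * p) ∣ n → (p * p) ∣ n
p³∣n⇒p²∣n p n d = ∣-trans (m∣m*n p) d

-- If all p×p windows of A have the same sum, then A r' c' − A r' c = A r c' − A r c whenever
-- r ≡ r' and c ≡ c' (mod p), so A r c = A r (c mod p) + A (r mod p) c − A (r mod p) (c mod p).
-- The index map σ behind θ fixes residues mod p when p³ ∣ n, and a broken diagonal of θ(R) is
-- the image under σ × σ of the broken diagonal {(i, h i)} of R. Summing the decomposition along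
-- {(σ i, σ (h i))}, each of the three parts sees one coordinate only up to its residue, so it can
-- be reindexed by σ back to the sum along {(i, h i)}; hence θ(R) inherits the diagonal sums of R.
module Submission where

open import Defs
open import Data.Nat using (ℕ; _*_; NonZero)
open import Data.Nat.Divisibility using (_∣_)
open import Data.Nat.Primality using (Prime; prime⇒nonZero)

open import Data.Nat.Properties
open import Algebra.Properties.CommutativeSemigroup +-commutativeSemigroup using (interchange)
open import Algebra.Properties.CommutativeMonoid.Sum +-0-commutativeMonoid
  using (sum; sum-permute; sum-cong-≋)
open import Data.Fin using (Fin; toℕ; fromℕ<)
open import Data.Fin.Permutation using (Permutation; permutation)
open import Data.Fin.Properties using (toℕ<n; toℕ-fromℕ<; toℕ-injective)
open import Data.Nat using (zero; suc; _+_; _∸_; _<_; _≤_)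
open import Data.Nat.DivMod
open import Data.Nat.Divisibility using (∣-trans; m∣m*n; n∣m*n; ∣n⇒∣m*n; *-cancelˡ-∣)
open import Data.List using (_∷_; [])
open import Data.Nat.Tactic.RingSolver using (solve)
open import Data.Product using (_,_)
open import Function.Base using (_∘_)
open import Relation.Binary.PropositionalEquality

sumTo-cong : ∀ n {f g : ℕ → ℕ} → (∀ {i} → i < n → f i ≡ g i) → sumTo n f ≡ sumTo n g
sumTo-cong zero    eq = refl
sumTo-cong (suc n) eq = cong₂ _+_ (sumTo-cong n (λ i<n → eq (m<n⇒m<1+n i<n))) (eq ≤-refl)

sumTo-+ : ∀ n (f g : ℕ → ℕ) → sumTo n (λ i → f i + g i) ≡ sumTo n f + sumTo n g
sumTo-+ zero    f g = refl
sumTo-+ (suc n) f g = trans (cong (_+ (f n + g n)) (sumTo-+ n f g))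
                            (interchange (sumTo n f) (sumTo n g) (f n) (g n))

sumTo-suc : ∀ n (f : ℕ → ℕ) → sumTo (suc n) f ≡ f 0 + sumTo n (f ∘ suc)
sumTo-suc zero    f = +-comm 0 (f 0)
sumTo-suc (suc n) f = trans (cong (_+ f (suc n)) (sumTo-suc n f))
                            (+-assoc (f 0) (sumTo n (f ∘ suc)) (f (suc n)))

sumTo-shift : ∀ n (f : ℕ → ℕ) → sumTo n (f ∘ suc) + f 0 ≡ sumTo n f + f n
sumTo-shift n f = trans (+-comm _ (f 0)) (sym (sumTo-suc n f))

sumTo≡sum : ∀ n (f : ℕ → ℕ) → sumTo n f ≡ sum {n} (f ∘ toℕ)
sumTo≡sum zero    f = refl
sumTo≡sum (suc n) f = trans (sumTo-suc n f) (cong (f 0 +_) (sumTo≡sum n (f ∘ suc)))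

record IsPermutationBelow (n : ℕ) (f : ℕ → ℕ) : Set where
  field
    inverse   : ℕ → ℕ
    f-<       : ∀ {i} → i < n → f i < n
    inverse-< : ∀ {i} → i < n → inverse i < n
    inverseˡ  : ∀ {i} → i < n → inverse (f i) ≡ i
    inverseʳ  : ∀ {i} → i < n → f (inverse i) ≡ i

involution⇒isPermutationBelow : ∀ {n f} → (∀ {i} → i < n → f i < n) →
                                (∀ {i} → i < n → f (f i) ≡ i) → IsPermutationBelow n f
involution⇒isPermutationBelow {f = f} f-< ff = record
  { inverse = f ; f-< = f-< ; inverse-< = f-< ; inverseˡ = ff ; inverseʳ = ff }

sumTo-reindex : ∀ {n π} → IsPermutationBelow n π → ∀ f → sumTo n (f ∘ π) ≡ sumTo n f
sumTo-reindex {n} {π} perm f = begin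
  sumTo n (f ∘ π)         ≡⟨ sumTo≡sum n (f ∘ π) ⟩
  sum {n} (f ∘ π ∘ toℕ)   ≡⟨ sum-cong-≋ (λ i → cong f (sym (toℕ-fromℕ< (f-< (toℕ<n i))))) ⟩
  sum {n} (f ∘ toℕ ∘ to)  ≡⟨ sum-permute (f ∘ toℕ) fin-perm ⟨
  sum {n} (f ∘ toℕ)       ≡⟨ sumTo≡sum n f ⟨
  sumTo n f               ∎
  where
  open ≡-Reasoning
  open IsPermutationBelow perm
  to from : Fin n → Fin n
  to   i = fromℕ< (f-< (toℕ<n i))
  from i = fromℕ< (inverse-< (toℕ<n i))
  fin-perm : Permutation n n
  fin-perm = permutation to from
    (λ i → toℕ-injective (trans (toℕ-fromℕ< _) (trans (cong π (toℕ-fromℕ< _)) (inverseʳ (toℕ<n i)))))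
    (λ i → toℕ-injective (trans (toℕ-fromℕ< _) (trans (cong inverse (toℕ-fromℕ< _)) (inverseˡ (toℕ<n i)))))

%-+-congʳ : ∀ a {b c} m .{{_ : NonZero m}} → b % m ≡ c % m → (a + b) % m ≡ (a + c) % m
%-+-congʳ a {b} {c} m eq = begin
  (a + b) % m          ≡⟨ %-distribˡ-+ a b m ⟩
  (a % m + b % m) % m  ≡⟨ cong (λ x → (a % m + x) % m) eq ⟩
  (a % m + c % m) % m  ≡⟨ %-distribˡ-+ a c m ⟨
  (a + c) % m          ∎
  where open ≡-Reasoning

%-+-congˡ : ∀ {a b} c m .{{_ : NonZero m}} → a % m ≡ b % m → (a + c) % m ≡ (b + c) % m
%-+-congˡ {a} {b} c m eq =
  trans (cong (_% m) (+-comm a c)) (trans (%-+-congʳ c m eq) (cong (_% m) (+-comm c b)))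

[a+b%m]%m≡[a+b]%m : ∀ a b m .{{_ : NonZero m}} → (a + b % m) % m ≡ (a + b) % m
[a+b%m]%m≡[a+b]%m a b m = %-+-congʳ a m (m%n%n≡m%n b m)

[m∸b%m+b]%m≡0 : ∀ b m .{{_ : NonZero m}} → (m ∸ b % m + b) % m ≡ 0
[m∸b%m+b]%m≡0 b m = begin
  (m ∸ b % m + b) % m      ≡⟨ [a+b%m]%m≡[a+b]%m (m ∸ b % m) b m ⟨
  (m ∸ b % m + b % m) % m  ≡⟨ cong (_% m) (m∸n+n≡m (<⇒≤ (m%n<n b m))) ⟩
  m % m                    ≡⟨ n%n≡0 m ⟩
  0                        ∎
  where open ≡-Reasoning

%-+-cancelʳ : ∀ a b c m .{{_ : NonZero m}} → (a + c) % m ≡ (b + c) % m → a % m ≡ b % m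
%-+-cancelʳ a b c m eq = trans (sym (drop-c a)) (trans (%-+-congˡ (m ∸ c % m) m eq) (drop-c b))
  where
  drop-c : ∀ x → (x + c + (m ∸ c % m)) % m ≡ x % m
  drop-c x = begin
    (x + c + (m ∸ c % m)) % m      ≡⟨ cong (_% m) (trans (+-assoc x c _) (cong (x +_) (+-comm c _))) ⟩
    (x + (m ∸ c % m + c)) % m      ≡⟨ [a+b%m]%m≡[a+b]%m x (m ∸ c % m + c) m ⟨
    (x + (m ∸ c % m + c) % m) % m  ≡⟨ cong (λ y → (x + y) % m) ([m∸b%m+b]%m≡0 c m) ⟩
    (x + 0) % m                    ≡⟨ cong (_% m) (+-identityʳ x) ⟩
    x % m                          ∎
    where open ≡-Reasoning

-- a − b = c − d, stated without truncated subtraction.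
record SameDifference (a b c d : ℕ) : Set where
  constructor sameDifference
  field
    cross-sums : a + d ≡ c + b

open SameDifference

sameDifference-sym : ∀ {a b c d} → SameDifference a b c d → SameDifference c d a b
sameDifference-sym (sameDifference ab≈cd) = sameDifference (sym ab≈cd)

sameDifference-trans : ∀ {a b c d e f} → SameDifference a b c d → SameDifference c d e f →
                       SameDifference a b e f
sameDifference-trans {a} {b} {c} {d} {e} {f} (sameDifference ab≈cd) (sameDifference cd≈ef) =
  sameDifference (+-cancelˡ-≡ (c + d) _ _ (begin
  (c + d) + (a + f)  ≡⟨ solve (a ∷ c ∷ d ∷ f ∷ []) ⟩
  (a + d) + (c + f)  ≡⟨ cong₂ _+_ ab≈cd cd≈ef ⟩
  (c + b) + (e + d)  ≡⟨ solve (b ∷ c ∷ d ∷ e ∷ []) ⟩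
  (c + d) + (e + b)  ∎))
  where open ≡-Reasoning

sameDifference-compose : ∀ {a b c d e f} → SameDifference a b c d → SameDifference b e d f →
                         SameDifference a e c f
sameDifference-compose {a} {b} {c} {d} {e} {f} (sameDifference ab≈cd) (sameDifference be≈df) =
  sameDifference (+-cancelˡ-≡ (b + d) _ _ (begin
  (b + d) + (a + f)  ≡⟨ solve (a ∷ b ∷ d ∷ f ∷ []) ⟩
  (a + d) + (b + f)  ≡⟨ cong₂ _+_ ab≈cd be≈df ⟩
  (c + b) + (d + e)  ≡⟨ solve (b ∷ c ∷ d ∷ e ∷ []) ⟩
  (b + d) + (c + e)  ∎))
  where open ≡-Reasoning

module _ (p : ℕ) (A : ℕ → ℕ → ℕ) where

  window : ℕ → ℕ → ℕ
  window r c = sumTo p (λ a → sumTo p (λ b → A (r + a) (c + b)))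

  rowWindow : ℕ → ℕ → ℕ
  rowWindow r c = sumTo p (λ b → A r (c + b))

  Rectangle : ℕ → ℕ → ℕ → ℕ → Set
  Rectangle r c r' c' = SameDifference (A r c') (A r c) (A r' c') (A r' c)

  rowWindow-step : ∀ r c → SameDifference (A r (c + p)) (A r c) (rowWindow r (suc c)) (rowWindow r c)
  rowWindow-step r c = sameDifference (sym (begin
    rowWindow r (suc c) + A r c
      ≡⟨ cong₂ _+_ (sumTo-cong p (λ {b} _ → cong (A r) (sym (+-suc c b)))) (cong (A r) (sym (+-identityʳ c))) ⟩
    sumTo p (λ b → A r (c + suc b)) + A r (c + 0)
      ≡⟨ sumTo-shift p (λ b → A r (c + b)) ⟩
    rowWindow r c + A r (c + p)
      ≡⟨ +-comm _ (A r (c + p)) ⟩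
    A r (c + p) + rowWindow r c ∎))
    where open ≡-Reasoning

  module _ (window-suc : ∀ r c → window (suc r) c ≡ window r c) where

    rowWindow-periodic : ∀ r c → rowWindow r c ≡ rowWindow (r + p) c
    rowWindow-periodic r c = +-cancelˡ-≡ (window r c) _ _ (begin
      window r c + rowWindow r c
        ≡⟨ cong₂ _+_ (sym (window-suc r c)) (cong (λ x → rowWindow x c) (sym (+-identityʳ r))) ⟩
      window (suc r) c + rowWindow (r + 0) c
        ≡⟨ cong (_+ rowWindow (r + 0) c) (sumTo-cong p (λ {a} _ → cong (λ x → rowWindow x c) (sym (+-suc r a)))) ⟩
      sumTo p (λ a → rowWindow (r + suc a) c) + rowWindow (r + 0) c
        ≡⟨ sumTo-shift p (λ a → rowWindow (r + a) c) ⟩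
      window r c + rowWindow (r + p) c ∎)
      where open ≡-Reasoning

    rectangle-base : ∀ r c → Rectangle r c (r + p) (c + p)
    rectangle-base r c = sameDifference-trans (rowWindow-step r c)
      (subst₂ (λ x y → SameDifference x y (A (r + p) (c + p)) (A (r + p) c))
        (sym (rowWindow-periodic r (suc c))) (sym (rowWindow-periodic r c))
        (sameDifference-sym (rowWindow-step (r + p) c)))

    rectangle-height-p : ∀ b r c → Rectangle r c (r + p) (c + b * p)
    rectangle-height-p zero    r c rewrite +-identityʳ c = sameDifference (+-comm (A r c) (A (r + p) c))
    rectangle-height-p (suc b) r c =
      subst (Rectangle r c (r + p)) (trans (+-assoc c (b * p) p) (cong (c +_) (+-comm (b * p) p)))
        (sameDifference-compose (rectangle-base r (c + b * p)) (rectangle-height-p b r c))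

    rectangle-periods : ∀ a b r c → Rectangle r c (r + a * p) (c + b * p)
    rectangle-periods zero    b r c rewrite +-identityʳ r = sameDifference refl
    rectangle-periods (suc a) b r c =
      subst (λ x → Rectangle r c x (c + b * p)) (trans (+-assoc r (a * p) p) (cong (r +_) (+-comm (a * p) p)))
        (sameDifference-trans (rectangle-periods a b r c) (rectangle-height-p b (r + a * p) c))

    rectangle-% : .{{_ : NonZero p}} → ∀ r c → Rectangle (r % p) (c % p) r c
    rectangle-% r c = subst₂ (Rectangle (r % p) (c % p)) (sym (m≡m%n+[m/n]*n r p)) (sym (m≡m%n+[m/n]*n c p))
      (rectangle-periods (r / p) (c / p) (r % p) (c % p))

[a*s+u]%s≡u : ∀ a {u} s .{{_ : NonZero s}} → u < s → (a * s + u) % s ≡ u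
[a*s+u]%s≡u a {u} s u<s = trans (%-remove-+ˡ u (n∣m*n a)) (m<n⇒m%n≡m u<s)

[a*s+u]/s≡a : ∀ a {u} s .{{_ : NonZero s}} → u < s → (a * s + u) / s ≡ a
[a*s+u]/s≡a a {u} s u<s = begin
  (a * s + u) / s        ≡⟨ +-distrib-/ (a * s) u remainders-< ⟩
  a * s / s + u / s      ≡⟨ cong₂ _+_ (m*n/n≡m a s) (m<n⇒m/n≡0 u<s) ⟩
  a + 0                  ≡⟨ +-identityʳ a ⟩
  a                      ∎
  where
  open ≡-Reasoning
  remainders-< : a * s % s + u % s < s
  remainders-< = subst (_< s) (sym (cong₂ _+_ (m*n%n≡0 a s) (m<n⇒m%n≡m u<s))) u<s

a*s+u<b*s : ∀ {a b u} s → a < b → u < s → a * s + u < b * s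
a*s+u<b*s {a} {b} {u} s a<b u<s = begin-strict
  a * s + u  <⟨ +-monoʳ-< (a * s) u<s ⟩
  a * s + s  ≡⟨ +-comm (a * s) s ⟩
  suc a * s  ≤⟨ *-monoˡ-≤ s a<b ⟩
  b * s      ∎
  where open ≤-Reasoning

-- Writing x = (ℓ p + m) s + u with u < s and ℓ, m < p, block ℓ p + m goes to block m p + ℓ;
-- with s = n / p² this is θidx, so θ R = R ∘ (blockTranspose × blockTranspose) definitionally.
blockTranspose : (p s : ℕ) .{{_ : NonZero p}} .{{_ : NonZero s}} → ℕ → ℕ
blockTranspose p s x = ((x / s) % p * p + (x / s) / p) * s + x % s

module _ (p s : ℕ) .{{_ : NonZero p}} .{{_ : NonZero s}} where

  blockTranspose-% : p ∣ s → ∀ x → blockTranspose p s x % p ≡ x % p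
  blockTranspose-% p∣s x = trans (%-remove-+ˡ (x % s) (∣n⇒∣m*n ((x / s) % p * p + (x / s) / p) p∣s))
                                 (m∣n⇒o%n%m≡o%m p s x p∣s)

  module _ {x : ℕ} (x< : x < p * p * s) where

    private
      i ℓ m : ℕ
      i = x / s
      ℓ = i / p
      m = i % p
      i< : i < p * p
      i< = m<n*o⇒m/o<n x<
      ℓ< : ℓ < p
      ℓ< = m<n*o⇒m/o<n i<
      u< : x % s < s
      u< = m%n<n x s

    blockTranspose-< : blockTranspose p s x < p * p * s
    blockTranspose-< = a*s+u<b*s s (a*s+u<b*s p (m%n<n i p) ℓ<) u<

    blockTranspose-involutive : blockTranspose p s (blockTranspose p s x) ≡ x
    blockTranspose-involutive = begin
      blockTranspose p s (blockTranspose p s x)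
        ≡⟨ cong₂ (λ j u → (j % p * p + j / p) * s + u) ([a*s+u]/s≡a (m * p + ℓ) s u<) ([a*s+u]%s≡u (m * p + ℓ) s u<) ⟩
      ((m * p + ℓ) % p * p + (m * p + ℓ) / p) * s + x % s
        ≡⟨ cong₂ (λ a b → (a * p + b) * s + x % s) ([a*s+u]%s≡u m p ℓ<) ([a*s+u]/s≡a m p ℓ<) ⟩
      (ℓ * p + m) * s + x % s
        ≡⟨ cong (λ j → j * s + x % s) (trans (+-comm (ℓ * p) m) (sym (m≡m%n+[m/n]*n i p))) ⟩
      i * s + x % s
        ≡⟨ trans (+-comm (i * s) (x % s)) (sym (m≡m%n+[m/n]*n x s)) ⟩
      x ∎
      where open ≡-Reasoning

  blockTranspose-isPermutationBelow : IsPermutationBelow (p * p * s) (blockTranspose p s)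
  blockTranspose-isPermutationBelow = involution⇒isPermutationBelow blockTranspose-< blockTranspose-involutive

RespectsResidues : (p n : ℕ) .{{_ : NonZero p}} → (ℕ → ℕ) → Set
RespectsResidues p n f = ∀ {y z} → y < n → z < n → y % p ≡ z % p → f y % p ≡ f z % p

module _ (n : ℕ) .{{_ : NonZero n}} where

  shift : ℕ → ℕ → ℕ
  shift k i = (k + i) % n

  reflect : ℕ → ℕ → ℕ
  reflect k i = (k + (n ∸ i)) % n

  shift-shift : ∀ {a b i} → (a + b) % n ≡ 0 → i < n → shift a (shift b i) ≡ i
  shift-shift {a} {b} {i} a+b≡0 i<n = begin
    (a + (b + i) % n) % n  ≡⟨ [a+b%m]%m≡[a+b]%m a (b + i) n ⟩
    (a + (b + i)) % n      ≡⟨ cong (_% n) (+-assoc a b i) ⟨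
    (a + b + i) % n        ≡⟨ %-+-congˡ i n (m%n%n≡m%n (a + b) n) ⟨
    ((a + b) % n + i) % n  ≡⟨ cong (λ x → (x + i) % n) a+b≡0 ⟩
    i % n                  ≡⟨ m<n⇒m%n≡m i<n ⟩
    i                      ∎
    where open ≡-Reasoning

  shift-isPermutationBelow : ∀ k → IsPermutationBelow n (shift k)
  shift-isPermutationBelow k = record
    { inverse   = shift k⁻¹
    ; f-<       = λ _ → m%n<n _ n
    ; inverse-< = λ _ → m%n<n _ n
    ; inverseˡ  = shift-shift ([m∸b%m+b]%m≡0 k n)
    ; inverseʳ  = shift-shift (trans (cong (_% n) (+-comm k k⁻¹)) ([m∸b%m+b]%m≡0 k n))
    }
    where
    k⁻¹ : ℕ
    k⁻¹ = n ∸ k % n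

  [reflect+i]%n : ∀ k {i} → i ≤ n → (reflect k i + i) % n ≡ (k + n) % n
  [reflect+i]%n k {i} i≤n = begin
    ((k + (n ∸ i)) % n + i) % n  ≡⟨ %-+-congˡ i n (m%n%n≡m%n (k + (n ∸ i)) n) ⟩
    (k + (n ∸ i) + i) % n        ≡⟨ cong (_% n) (trans (+-assoc k (n ∸ i) i) (cong (k +_) (m∸n+n≡m i≤n))) ⟩
    (k + n) % n                  ∎
    where open ≡-Reasoning

  reflect-involutive : ∀ k {i} → i < n → reflect k (reflect k i) ≡ i
  reflect-involutive k {i} i<n = begin
    reflect k (reflect k i)      ≡⟨ m%n%n≡m%n (k + (n ∸ reflect k i)) n ⟨
    reflect k (reflect k i) % n  ≡⟨ %-+-cancelʳ _ i (reflect k i) n both-sum-to-k ⟩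
    i % n                        ≡⟨ m<n⇒m%n≡m i<n ⟩
    i                            ∎
    where
    open ≡-Reasoning
    both-sum-to-k : (reflect k (reflect k i) + reflect k i) % n ≡ (i + reflect k i) % n
    both-sum-to-k = trans ([reflect+i]%n k (<⇒≤ (m%n<n _ n)))
      (trans (sym ([reflect+i]%n k (<⇒≤ i<n))) (cong (_% n) (+-comm (reflect k i) i)))

  module _ {p : ℕ} .{{_ : NonZero p}} (p∣n : p ∣ n) where

    shift-respectsResidues : ∀ k → RespectsResidues p n (shift k)
    shift-respectsResidues k {y} {z} _ _ y≡z = begin
      (k + y) % n % p  ≡⟨ m∣n⇒o%n%m≡o%m p n (k + y) p∣n ⟩
      (k + y) % p      ≡⟨ %-+-congʳ k p y≡z ⟩
      (k + z) % p      ≡⟨ m∣n⇒o%n%m≡o%m p n (k + z) p∣n ⟨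
      (k + z) % n % p  ∎
      where open ≡-Reasoning

    reflect-respectsResidues : ∀ k → RespectsResidues p n (reflect k)
    reflect-respectsResidues k {y} {z} y<n z<n y≡z = %-+-cancelʳ _ _ z p (begin
      (reflect k y + z) % p      ≡⟨ %-+-congʳ (reflect k y) p y≡z ⟨
      (reflect k y + y) % p      ≡⟨ sum-% y<n ⟩
      (k + n) % n % p            ≡⟨ sum-% z<n ⟨
      (reflect k z + z) % p      ∎)
      where
      open ≡-Reasoning
      sum-% : ∀ {x} → x < n → (reflect k x + x) % p ≡ (k + n) % n % p
      sum-% {x} x<n = trans (sym (m∣n⇒o%n%m≡o%m p n _ p∣n)) (cong (_% p) ([reflect+i]%n k (<⇒≤ x<n)))

module _ {p n : ℕ} .{{_ : NonZero p}} {σ : ℕ → ℕ} (σ-perm : IsPermutationBelow n σ)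
         (σ-% : ∀ {i} → i < n → σ i % p ≡ i % p) where

  open IsPermutationBelow σ-perm using () renaming (f-< to σ-<)

  sumTo-residueFixing-invariant : ∀ {h} → RespectsResidues p n h → (F : ℕ → ℕ → ℕ) →
    sumTo n (λ i → F (σ i) (h i % p)) ≡ sumTo n (λ i → F i (h i % p))
  sumTo-residueFixing-invariant {h} h-resp F =
    trans (sumTo-cong n (λ {i} i<n → cong (F (σ i)) (h-resp i<n (σ-< i<n) (sym (σ-% i<n)))))
          (sumTo-reindex σ-perm (λ y → F y (h y % p)))

  module _ (A : ℕ → ℕ → ℕ) (rect : ∀ r c → Rectangle p A (r % p) (c % p) r c)
           {h : ℕ → ℕ} (h-perm : IsPermutationBelow n h)
           (h-resp : RespectsResidues p n h)
           (h⁻¹-resp : RespectsResidues p n (IsPermutationBelow.inverse h-perm)) where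

    open IsPermutationBelow h-perm using (inverseˡ) renaming (f-< to h-<; inverse to h⁻¹)

    sumTo-rectangle : ∀ (f g : ℕ → ℕ) →
      sumTo n (λ i → A (f i % p) (g i)) + sumTo n (λ i → A (f i) (g i % p)) ≡
      sumTo n (λ i → A (f i) (g i)) + sumTo n (λ i → A (f i % p) (g i % p))
    sumTo-rectangle f g = trans (sym (sumTo-+ n _ _))
      (trans (sumTo-cong n (λ {i} _ → cross-sums (rect (f i) (g i)))) (sumTo-+ n _ _))

    private
      corners : sumTo n (λ i → A (σ i % p) (σ (h i) % p)) ≡ sumTo n (λ i → A (i % p) (h i % p))
      corners = sumTo-cong n (λ i<n → cong₂ A (σ-% i<n) (σ-% (h-< i<n)))

      rows-mod-p : sumTo n (λ i → A (σ i) (σ (h i) % p)) ≡ sumTo n (λ i → A i (h i % p))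
      rows-mod-p = trans (sumTo-cong n (λ {i} i<n → cong (A (σ i)) (σ-% (h-< i<n))))
                         (sumTo-residueFixing-invariant h-resp A)

      columns-mod-p : sumTo n (λ i → A (σ i % p) (σ (h i))) ≡ sumTo n (λ i → A (i % p) (h i))
      columns-mod-p = begin
        sumTo n (λ i → A (σ i % p) (σ (h i)))         ≡⟨ sumTo-cong n (λ {i} i<n →
                                                           cong (λ x → A x (σ (h i))) (trans (σ-% i<n) (cong (_% p) (sym (inverseˡ i<n))))) ⟩
        sumTo n (λ i → A (h⁻¹ (h i) % p) (σ (h i)))   ≡⟨ sumTo-reindex h-perm (λ j → A (h⁻¹ j % p) (σ j)) ⟩
        sumTo n (λ j → A (h⁻¹ j % p) (σ j))           ≡⟨ sumTo-residueFixing-invariant h⁻¹-resp (λ x y → A y x) ⟩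
        sumTo n (λ j → A (h⁻¹ j % p) j)               ≡⟨ sumTo-reindex h-perm (λ j → A (h⁻¹ j % p) j) ⟨
        sumTo n (λ i → A (h⁻¹ (h i) % p) (h i))       ≡⟨ sumTo-cong n (λ {i} i<n → cong (λ x → A (x % p) (h i)) (inverseˡ i<n)) ⟩
        sumTo n (λ i → A (i % p) (h i))               ∎
        where open ≡-Reasoning

    sumTo-conjugate-invariant : sumTo n (λ i → A (σ i) (σ (h i))) ≡ sumTo n (λ i → A i (h i))
    sumTo-conjugate-invariant = +-cancelʳ-≡ (sumTo n (λ i → A (i % p) (h i % p))) _ _ (begin
      sumTo n (λ i → A (σ i) (σ (h i))) + sumTo n (λ i → A (i % p) (h i % p))
        ≡⟨ cong (_ +_) corners ⟨
      sumTo n (λ i → A (σ i) (σ (h i))) + sumTo n (λ i → A (σ i % p) (σ (h i) % p))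
        ≡⟨ sumTo-rectangle σ (σ ∘ h) ⟨
      sumTo n (λ i → A (σ i % p) (σ (h i))) + sumTo n (λ i → A (σ i) (σ (h i) % p))
        ≡⟨ cong₂ _+_ columns-mod-p rows-mod-p ⟩
      sumTo n (λ i → A (i % p) (h i)) + sumTo n (λ i → A i (h i % p))
        ≡⟨ sumTo-rectangle (λ i → i) h ⟩
      sumTo n (λ i → A i (h i)) + sumTo n (λ i → A (i % p) (h i % p)) ∎)
      where open ≡-Reasoning

at-%ʳ : ∀ {n} .{{_ : NonZero n}} (R : Square n) r c → at R r (c % n) ≡ at R r c
at-%ʳ {n} R r c = cong (R (ix n r))
  (toℕ-injective (trans (toℕ-fromℕ< _) (trans (m%n%n≡m%n c n) (sym (toℕ-fromℕ< _)))))

module _ (p n : ℕ) (pr : Prime p) .{{_ : NonZero n}} (d : p * p * p ∣ n) (R : Square n)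
         (window-suc : ∀ r c → window p (at R) (suc r) c ≡ window p (at R) r c) where

  private instance
    _ = prime⇒nonZero pr
    _ = m*n≢0 p p
    _ = blockSize-nonZero p n pr (p³∣n⇒p²∣n p n d)

  private
    s : ℕ
    s = blockSize p n pr

    σ : ℕ → ℕ
    σ = blockTranspose p s

    n≡p*p*s : n ≡ p * p * s
    n≡p*p*s = sym (m*[n/m]≡n (p³∣n⇒p²∣n p n d))

    σ-isPermutationBelow : IsPermutationBelow n σ
    σ-isPermutationBelow = subst (λ m → IsPermutationBelow m σ) (sym n≡p*p*s) (blockTranspose-isPermutationBelow p s)

    -- The one use of p³ ∣ n: the block size n / p² is a multiple of p.
    σ-% : ∀ x → σ x % p ≡ x % p
    σ-% = blockTranspose-% p s (*-cancelˡ-∣ (p * p) (subst (p * p * p ∣_) n≡p*p*s d))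

  θ-preserves-sumTo : ∀ (c : ℕ → ℕ) (c-perm : IsPermutationBelow n (λ i → c i % n)) →
    RespectsResidues p n (λ i → c i % n) → RespectsResidues p n (IsPermutationBelow.inverse c-perm) →
    sumTo n (λ i → at (θ p n pr (p³∣n⇒p²∣n p n d) R) i (c i)) ≡ sumTo n (λ i → at R i (c i))
  θ-preserves-sumTo c c-perm c-resp c⁻¹-resp = begin
    sumTo n (λ i → at (θ p n pr (p³∣n⇒p²∣n p n d) R) i (c i))
      ≡⟨ sumTo-cong n (λ i<n → cong₂ (λ a b → at R (σ a) (σ b)) (trans (toℕ-fromℕ< _) (m<n⇒m%n≡m i<n)) (toℕ-fromℕ< _)) ⟩
    sumTo n (λ i → at R (σ i) (σ (c i % n)))
      ≡⟨ sumTo-conjugate-invariant {p} σ-isPermutationBelow (λ _ → σ-% _) (at R)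
           (rectangle-% p (at R) window-suc) c-perm c-resp c⁻¹-resp ⟩
    sumTo n (λ i → at R i (c i % n))
      ≡⟨ sumTo-cong n (λ {i} _ → at-%ʳ R i (c i)) ⟩
    sumTo n (λ i → at R i (c i)) ∎
    where open ≡-Reasoning

proposition2p5 : (p n : ℕ) (pr : Prime p) .{{_ : NonZero n}} →
    (d : (p * p * p) ∣ n) → (R : Square n) →
    MostPerfect p n {{prime⇒nonZero pr}} R →
    PandiagonalSums n (θ p n pr (p³∣n⇒p²∣n p n d) R)
proposition2p5 p n pr d R ((_ , _ , _ , diagonal , antidiagonal) , _ , windows) =
  (λ k → trans (cong (2 *_) (θ-preserves-sumTo p n pr d R window-suc (k +_) (shift-isPermutationBelow n k)
                               (shift-respectsResidues n p∣n k) (shift-respectsResidues n p∣n _)))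
               (diagonal k)) ,
  (λ k → trans (cong (2 *_) (θ-preserves-sumTo p n pr d R window-suc (λ i → k + (n ∸ i)) (reflect-isPermutationBelow k)
                               (reflect-respectsResidues n p∣n k) (reflect-respectsResidues n p∣n k)))
               (antidiagonal k))
  where
  instance _ = prime⇒nonZero pr
  p∣n : p ∣ n
  p∣n = ∣-trans (m∣m*n p) (p³∣n⇒p²∣n p n d)
  window-suc : ∀ r c → window p (at R) (suc r) c ≡ window p (at R) r c
  window-suc r c = *-cancelˡ-≡ _ _ 2 (trans (windows (suc r) c) (sym (windows r c)))
  reflect-isPermutationBelow : ∀ k → IsPermutationBelow n (reflect n k)
  reflect-isPermutationBelow k = involution⇒isPermutationBelow (λ _ → m%n<n _ n) (reflect-involutive n k)
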